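{- Let $G$ be a connected $d$-regular simple graph on $n$ vertices with $d>\frac{n}{2}-1$. Let $L$ be its Laplacian, $L^{\dagger}$ the Moore–Penrose pseudo-inverse of $L$, $f=\max_{i} L^{\dagger}_{ii}$ and $o=\max_{i\neq j}|L^{\dagger}_{ij}|$. Then $$ o \leq \frac{f}{2d-n+3}+\frac{2}{n^2}.$$
   Context: The Laplacian $L$ has $L_{ii}=d$, $L_{ij}=-1$ for adjacent $i\ne j$, $0$ otherwise. The Moore–Penrose pseudo-inverse of $L$ is the unique matrix $X$ with $LXL=L$, $XLX=X$, and $LX$, $XL$ symmetric. -}

module Defs where

open import Data.Nat as ℕ using (ℕ; zero; suc)
open import Data.Fin using (Fin; zero; suc)
open import Data.Bool using (Bool; true; false; if_then_else_)
open import Data.Integer using (+_)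
open import Data.Rational using (ℚ; 0ℚ; _+_; _*_; -_; _⊔_; _/_)
open import Relation.Binary.PropositionalEquality using (_≡_)
open import Relation.Nullary using (¬_)
open import Relation.Binary.Construct.Closure.ReflexiveTransitive using (Star)

record SimpleGraph (n : ℕ) : Set where
  field
    Adj   : Fin n → Fin n → Bool
    sym   : ∀ i j → Adj i j ≡ Adj j i
    irrefl : ∀ i → Adj i i ≡ false
open SimpleGraph public

count : ∀ {n} → (Fin n → Bool) → ℕ
count {zero} p = 0
count {suc n} p = (if p zero then 1 else 0) ℕ.+ count (λ j → p (suc j))

degree : ∀ {n} → SimpleGraph n → Fin n → ℕ
degree G i = count (Adj G i)

IsRegular : ∀ {n} → SimpleGraph n → ℕ → Set
IsRegular G d = ∀ i → degree G i ≡ d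

Adjacent : ∀ {n} → SimpleGraph n → Fin n → Fin n → Set
Adjacent G i j = Adj G i j ≡ true

Connected : ∀ {n} → SimpleGraph n → Set
Connected G = ∀ i j → Star (Adjacent G) i j

Matrix : ℕ → Set
Matrix n = Fin n → Fin n → ℚ

ℕtoℚ : ℕ → ℚ
ℕtoℚ k = + k / 1

laplacian : ∀ {n} → SimpleGraph n → Matrix n
laplacian {n} G i j with i Data.Fin.≟ j
  where import Data.Fin
... | Relation.Nullary.yes _ = ℕtoℚ (degree G i)
... | Relation.Nullary.no _ = if Adj G i j then - (ℕtoℚ 1) else 0ℚ

sumℚ : ∀ {n} → (Fin n → ℚ) → ℚ
sumℚ {zero} f = 0ℚ
sumℚ {suc n} f = f zero + sumℚ (λ j → f (suc j))

_·_ : ∀ {n} → Matrix n → Matrix n → Matrix n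
(A · B) i j = sumℚ (λ k → A i k * B k j)

transpose : ∀ {n} → Matrix n → Matrix n
transpose A i j = A j i

IsMoorePenroseInverse : ∀ {n} → Matrix n → Matrix n → Set
IsMoorePenroseInverse L X =
  (∀ i j → ((L · X) · L) i j ≡ L i j) ×
  (∀ i j → ((X · L) · X) i j ≡ X i j) ×
  (∀ i j → (L · X) i j ≡ (L · X) j i) ×
  (∀ i j → (X · L) i j ≡ (X · L) j i)
  where open import Data.Product using (_×_)

maxFin : ∀ {m} → (Fin (suc m) → ℚ) → ℚ
maxFin {zero} f = f zero
maxFin {suc m} f = f zero ⊔ maxFin (λ j → f (suc j))

maxDiag : ∀ {m} → Matrix (suc m) → ℚ
maxDiag X = maxFin (λ i → X i i)

module Submission where

open import Defs
open import Data.Nat as ℕ using (ℕ; suc; _∸_; _<_)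
open import Data.Fin using (Fin)
open import Data.Integer using (+_)
open import Data.Rational using (ℚ; _≤_; _+_; _*_; _/_; ∣_∣)
open import Relation.Binary.PropositionalEquality using (_≡_)
open import Relation.Nullary using (¬_)

open import Data.Bool using (Bool; true; false; if_then_else_; not)
open import Data.Empty using (⊥-elim)
open import Data.Fin using (zero; suc)
import Data.Fin as F
open import Data.Fin.Properties using (suc-injective)
import Data.Integer as ℤ
import Data.Integer.Solver
import Data.Nat.Properties as ℕP
open import Data.Product using (Σ; _,_; proj₁; proj₂)
open import Data.Rational using (0ℚ; 1ℚ; -_; _-_; toℚᵘ; nonNegative; positive)
import Data.Rational as Q
open import Data.Rational.Properties
open import Data.Rational.Solver using (module +-*-Solver)
import Data.Rational.Unnormalised as U
import Data.Rational.Unnormalised.Properties as UP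
open import Data.Sum using (inj₁; inj₂)
open import Relation.Binary.Construct.Closure.ReflexiveTransitive using (Star; ε; _◅_)
open import Relation.Binary.PropositionalEquality
  using (refl; trans; cong; cong₂; subst; module ≡-Reasoning)
  renaming (sym to ≡-sym)
open import Relation.Nullary using (yes; no)

open +-*-Solver
module ℤS = Data.Integer.Solver.+-*-Solver

-- Proof idea.  Write n = suc m, t = 1/n and J for the all-ones matrix.
--
-- (1) Kernel: on a connected graph every L-harmonic vector (L v = 0) is
--     constant, since at a maximiser of v the row equation forces all
--     neighbours to share the maximum, and walks spread this everywhere.
-- (2) Moore–Penrose: the rows of I − J/n − L X are L-harmonic (by L X L = L)
--     and have zero sum (by symmetry of L X), so L X = I − J/n.  Likewise
--     X L X = X together with the symmetry of X L gives zero column sums of X.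
-- (3) Column analysis: fix a column x = X(·, j).  Then Σ x = 0 and
--     d x_i − Σ_{k∼i} x_k = δ_ij − t.  With d-regularity this makes x_j the
--     maximum of x and, writing Q = −min x, gives (d+1) x_k ≤ −t + (c−1) Q for
--     k ≠ j, where c = n − d = d + 2 − κ counts non-neighbours and
--     κ = 2d + 2 − n ≥ 1.  Applying this to the non-neighbours of a minimiser
--     yields Q ≤ x_j/(κ+1) + 2/n², and |x_i| ≤ Q for i ≠ j.
-- (4) The theorem follows since x_j = X_jj ≤ max_i X_ii.

-- ℕtoℚ is a semiring embedding; its identities are integer identities
-- once the rationals are viewed unnormalised.
ℕtoℚ-unnorm : ∀ k → toℚᵘ (ℕtoℚ k) U.≃ U.mkℚᵘ (+ k) 0
ℕtoℚ-unnorm k = toℚᵘ-fromℚᵘ (U.mkℚᵘ (+ k) 0)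

ℕtoℚ-suc : ∀ k → ℕtoℚ (suc k) ≡ 1ℚ + ℕtoℚ k
ℕtoℚ-suc k = toℚᵘ-injective (UP.≃-trans (ℕtoℚ-unnorm (suc k))
  (UP.≃-trans (U.*≡* cross) (UP.≃-sym (UP.≃-trans (toℚᵘ-homo-+ 1ℚ (ℕtoℚ k))
    (UP.+-cong (ℕtoℚ-unnorm 1) (ℕtoℚ-unnorm k))))))
  where
  cross : + suc k ℤ.* + 1 ≡ (+ 1 ℤ.* + 1 ℤ.+ + k ℤ.* + 1) ℤ.* + 1
  cross = ℤS.solve 1 (λ y → (ℤS.con (+ 1) ℤS.:+ y) ℤS.:* ℤS.con (+ 1)
    ℤS.:= (ℤS.con (+ 1) ℤS.:* ℤS.con (+ 1) ℤS.:+ y ℤS.:* ℤS.con (+ 1)) ℤS.:* ℤS.con (+ 1)) refl (+ k)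

ℕtoℚ-*-/ : ∀ a k → ℕtoℚ (suc a) * (+ k / suc a) ≡ ℕtoℚ k
ℕtoℚ-*-/ a k = toℚᵘ-injective (UP.≃-trans (toℚᵘ-homo-* (ℕtoℚ (suc a)) (+ k / suc a))
  (UP.≃-trans (UP.*-cong (ℕtoℚ-unnorm (suc a)) (toℚᵘ-fromℚᵘ (U.mkℚᵘ (+ k) a)))
    (UP.≃-trans (U.*≡* cross) (UP.≃-sym (ℕtoℚ-unnorm k)))))
  where
  cross : (+ suc a ℤ.* + k) ℤ.* + 1 ≡ + k ℤ.* (+ 1 ℤ.* + suc a)
  cross = ℤS.solve 2 (λ y z → (y ℤS.:* z) ℤS.:* ℤS.con (+ 1) ℤS.:= z ℤS.:* (ℤS.con (+ 1) ℤS.:* y))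
    refl (+ suc a) (+ k)

ℕtoℚ-+ : ∀ a b → ℕtoℚ (a ℕ.+ b) ≡ ℕtoℚ a + ℕtoℚ b
ℕtoℚ-+ ℕ.zero b = ≡-sym (+-identityˡ (ℕtoℚ b))
ℕtoℚ-+ (suc a) b = begin
    ℕtoℚ (suc (a ℕ.+ b))           ≡⟨ ℕtoℚ-suc (a ℕ.+ b) ⟩
    1ℚ + ℕtoℚ (a ℕ.+ b)            ≡⟨ cong (λ z → 1ℚ + z) (ℕtoℚ-+ a b) ⟩
    1ℚ + (ℕtoℚ a + ℕtoℚ b)         ≡⟨ ≡-sym (+-assoc 1ℚ (ℕtoℚ a) (ℕtoℚ b)) ⟩
    1ℚ + ℕtoℚ a + ℕtoℚ b           ≡⟨ cong (_+ ℕtoℚ b) (≡-sym (ℕtoℚ-suc a)) ⟩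
    ℕtoℚ (suc a) + ℕtoℚ b          ∎
  where open ≡-Reasoning

ℕtoℚ-* : ∀ a b → ℕtoℚ (a ℕ.* b) ≡ ℕtoℚ a * ℕtoℚ b
ℕtoℚ-* ℕ.zero b = ≡-sym (*-zeroˡ (ℕtoℚ b))
ℕtoℚ-* (suc a) b = begin
    ℕtoℚ (b ℕ.+ a ℕ.* b)           ≡⟨ ℕtoℚ-+ b (a ℕ.* b) ⟩
    ℕtoℚ b + ℕtoℚ (a ℕ.* b)        ≡⟨ cong (λ z → ℕtoℚ b + z) (ℕtoℚ-* a b) ⟩
    ℕtoℚ b + ℕtoℚ a * ℕtoℚ b       ≡⟨ solve 2 (λ y z → z :+ y :* z := (con 1ℚ :+ y) :* z) refl (ℕtoℚ a) (ℕtoℚ b) ⟩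
    (1ℚ + ℕtoℚ a) * ℕtoℚ b         ≡⟨ cong (_* ℕtoℚ b) (≡-sym (ℕtoℚ-suc a)) ⟩
    ℕtoℚ (suc a) * ℕtoℚ b          ∎
  where open ≡-Reasoning

0≤1 : 0ℚ ≤ 1ℚ
0≤1 = ≤ᵇ⇒≤ _

0<1 : 0ℚ Q.< 1ℚ
0<1 = Q.*<* (ℤ.+<+ (ℕ.s≤s ℕ.z≤n))

neg-involutive : ∀ p → - (- p) ≡ p
neg-involutive = solve 1 (λ p → :- (:- p) := p) refl

diff-nonNeg⇒≤ : ∀ {p q} → 0ℚ ≤ q - p → p ≤ q
diff-nonNeg⇒≤ {p} {q} h = ≤-trans (≤-reflexive (≡-sym (+-identityʳ p)))
  (≤-trans (+-monoʳ-≤ p h) (≤-reflexive (solve 2 (λ p q → p :+ (q :- p) := q) refl p q)))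

≤⇒diff-nonNeg : ∀ {p q} → p ≤ q → 0ℚ ≤ q - p
≤⇒diff-nonNeg {p} {q} h = ≤-trans (≤-reflexive (≡-sym (+-inverseʳ p))) (+-monoˡ-≤ (- p) h)

≤⇒diff-nonPos : ∀ {p q} → p ≤ q → p - q ≤ 0ℚ
≤⇒diff-nonPos {p} {q} h = ≤-trans (+-monoˡ-≤ (- q) h) (≤-reflexive (+-inverseʳ q))

diff-nonPos⇒≤ : ∀ {p q} → p - q ≤ 0ℚ → p ≤ q
diff-nonPos⇒≤ {p} {q} h = ≤-trans (≤-reflexive (solve 2 (λ p q → p := (p :- q) :+ q) refl p q))
  (≤-trans (+-monoˡ-≤ q h) (≤-reflexive (+-identityˡ q)))

+-nonNeg : ∀ {p q} → 0ℚ ≤ p → 0ℚ ≤ q → 0ℚ ≤ p + q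
+-nonNeg hp hq = ≤-trans (≤-reflexive (≡-sym (+-identityʳ 0ℚ))) (+-mono-≤ hp hq)

*-nonNeg : ∀ {p q} → 0ℚ ≤ p → 0ℚ ≤ q → 0ℚ ≤ p * q
*-nonNeg {p} hp hq = ≤-trans (≤-reflexive (≡-sym (*-zeroʳ p))) (*-monoˡ-≤-nonNeg p {{nonNegative hp}} hq)

*-pos : ∀ {p q} → 0ℚ Q.< p → 0ℚ Q.< q → 0ℚ Q.< p * q
*-pos {p} {q} hp hq = positive⁻¹ (p * q) {{pos*pos⇒pos p {{positive hp}} q {{positive hq}}}}

cancel-≤ : ∀ r {p q} → 0ℚ Q.< r → r * p ≤ r * q → p ≤ q
cancel-≤ r h = *-cancelˡ-≤-pos r {{positive h}}

∣∣-≤ : ∀ {p b} → p ≤ b → - p ≤ b → ∣ p ∣ ≤ b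
∣∣-≤ {p} h₁ h₂ with ∣p∣≡p∨∣p∣≡-p p
... | inj₁ eq = ≤-trans (≤-reflexive eq) h₁
... | inj₂ eq = ≤-trans (≤-reflexive eq) h₂

-- Linear certificate for an inequality: C ≤ E follows from A ≤ B once
-- E − C = k (B − A) + s + z with k, s ≥ 0 and z = 0.  All the numerical
-- estimates below are discharged this way, the identity by the ring solver.
≤-by-certificate : ∀ {C E} k s z {A B} → A ≤ B → 0ℚ ≤ k → 0ℚ ≤ s → z ≡ 0ℚ →
                   E - C ≡ k * (B - A) + s + z → C ≤ E
≤-by-certificate k s z {A} {B} A≤B k≥0 s≥0 z≡0 eq = diff-nonNeg⇒≤ (≤-trans
  (+-nonNeg (*-nonNeg k≥0 (≤⇒diff-nonNeg A≤B)) s≥0)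
  (≤-reflexive (≡-sym (trans eq (trans (cong (λ z → k * (B - A) + s + z) z≡0) (+-identityʳ _))))))

ℕtoℚ-nonNeg : ∀ a → 0ℚ ≤ ℕtoℚ a
ℕtoℚ-nonNeg ℕ.zero = ≤-refl
ℕtoℚ-nonNeg (suc a) = ≤-trans (+-nonNeg 0≤1 (ℕtoℚ-nonNeg a)) (≤-reflexive (≡-sym (ℕtoℚ-suc a)))

ℕtoℚ-pos : ∀ {a} → 0 < a → 0ℚ Q.< ℕtoℚ a
ℕtoℚ-pos {suc a} _ = <-≤-trans
  (≤-<-trans (≤-reflexive (≡-sym (+-identityʳ 0ℚ))) (+-mono-<-≤ 0<1 (ℕtoℚ-nonNeg a)))
  (≤-reflexive (≡-sym (ℕtoℚ-suc a)))

sum-cong : ∀ {n} {f g : Fin n → ℚ} → (∀ k → f k ≡ g k) → sumℚ f ≡ sumℚ g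
sum-cong {ℕ.zero} h = refl
sum-cong {suc n} h = cong₂ _+_ (h zero) (sum-cong (λ k → h (suc k)))

sum-+ : ∀ {n} (f g : Fin n → ℚ) → sumℚ (λ k → f k + g k) ≡ sumℚ f + sumℚ g
sum-+ {ℕ.zero} f g = refl
sum-+ {suc n} f g = trans (cong (λ z → f zero + g zero + z) (sum-+ (λ k → f (suc k)) (λ k → g (suc k))))
  (solve 4 (λ a b c d → a :+ b :+ (c :+ d) := a :+ c :+ (b :+ d)) refl
     (f zero) (g zero) (sumℚ (λ k → f (suc k))) (sumℚ (λ k → g (suc k))))

sum-*ˡ : ∀ {n} c (f : Fin n → ℚ) → sumℚ (λ k → c * f k) ≡ c * sumℚ f
sum-*ˡ {ℕ.zero} c f = ≡-sym (*-zeroʳ c)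
sum-*ˡ {suc n} c f = trans (cong (λ z → c * f zero + z) (sum-*ˡ c (λ k → f (suc k)))) (≡-sym (*-distribˡ-+ c _ _))

sum-*ʳ : ∀ {n} (f : Fin n → ℚ) c → sumℚ (λ k → f k * c) ≡ sumℚ f * c
sum-*ʳ f c = trans (sum-cong (λ k → *-comm (f k) c)) (trans (sum-*ˡ c f) (*-comm c (sumℚ f)))

sum-neg : ∀ {n} (f : Fin n → ℚ) → sumℚ (λ k → - f k) ≡ - sumℚ f
sum-neg {ℕ.zero} f = refl
sum-neg {suc n} f = trans (cong (λ z → - f zero + z) (sum-neg (λ k → f (suc k))))
  (≡-sym (neg-distrib-+ (f zero) (sumℚ (λ k → f (suc k)))))

sum-zero : ∀ {n} (f : Fin n → ℚ) → (∀ k → f k ≡ 0ℚ) → sumℚ f ≡ 0ℚ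
sum-zero {ℕ.zero} f h = refl
sum-zero {suc n} f h = trans (cong₂ _+_ (h zero) (sum-zero (λ k → f (suc k)) (λ k → h (suc k)))) (+-identityˡ 0ℚ)

sum-swap : ∀ {n p} (F : Fin n → Fin p → ℚ) →
           sumℚ (λ i → sumℚ (λ k → F i k)) ≡ sumℚ (λ k → sumℚ (λ i → F i k))
sum-swap {ℕ.zero} {p} F = ≡-sym (sum-zero {p} (λ _ → 0ℚ) (λ _ → refl))
sum-swap {suc n} F = trans (cong (λ z → sumℚ (λ k → F zero k) + z) (sum-swap (λ i k → F (suc i) k)))
  (≡-sym (sum-+ (λ k → F zero k) (λ k → sumℚ (λ i → F (suc i) k))))

sum-point : ∀ {n} (f : Fin n → ℚ) i → (∀ k → ¬ k ≡ i → f k ≡ 0ℚ) → sumℚ f ≡ f i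
sum-point {suc n} f zero h = trans (cong (λ z → f zero + z) (sum-zero _ (λ k → h (suc k) (λ ())))) (+-identityʳ _)
sum-point {suc n} f (suc i) h = trans (cong (_+ sumℚ (λ k → f (suc k))) (h zero (λ ())))
  (trans (+-identityˡ _) (sum-point (λ k → f (suc k)) i (λ k k≢i → h (suc k) (λ eq → k≢i (suc-injective eq)))))

sum-const : ∀ {n} c → sumℚ {n} (λ _ → c) ≡ ℕtoℚ n * c
sum-const {ℕ.zero} c = ≡-sym (*-zeroˡ c)
sum-const {suc n} c = trans (cong (λ z → c + z) (sum-const {n} c))
  (trans (solve 2 (λ y c → c :+ y :* c := (con 1ℚ :+ y) :* c) refl (ℕtoℚ n) c) (cong (_* c) (≡-sym (ℕtoℚ-suc n))))

sum-mono : ∀ {n} {f g : Fin n → ℚ} → (∀ k → f k ≤ g k) → sumℚ f ≤ sumℚ g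
sum-mono {ℕ.zero} h = ≤-refl
sum-mono {suc n} h = +-mono-≤ (h zero) (sum-mono (λ k → h (suc k)))

δ : ∀ {n} → Fin n → Fin n → ℚ
δ i k with i F.≟ k
... | yes _ = 1ℚ
... | no _ = 0ℚ

δ-diag : ∀ {n} (i : Fin n) → δ i i ≡ 1ℚ
δ-diag i with i F.≟ i
... | yes _ = refl
... | no i≢i = ⊥-elim (i≢i refl)

δ-off : ∀ {n} {i k : Fin n} → ¬ i ≡ k → δ i k ≡ 0ℚ
δ-off {i = i} {k} i≢k with i F.≟ k
... | yes eq = ⊥-elim (i≢k eq)
... | no _ = refl

δ-sum : ∀ {n} (i : Fin n) (f : Fin n → ℚ) → sumℚ (λ k → δ i k * f k) ≡ f i
δ-sum i f = trans (sum-point (λ k → δ i k * f k) i off)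
  (trans (cong (_* f i) (δ-diag i)) (*-identityˡ (f i)))
  where
  off : ∀ k → ¬ k ≡ i → δ i k * f k ≡ 0ℚ
  off k k≢i = trans (cong (_* f k) (δ-off (λ eq → k≢i (≡-sym eq)))) (*-zeroˡ (f k))

sum-≤-point : ∀ {n} (f : Fin n → ℚ) i → (∀ k → ¬ k ≡ i → f k ≤ 0ℚ) → sumℚ f ≤ f i
sum-≤-point f i h = ≤-trans (sum-mono {g = λ k → δ i k * f i} bound)
  (≤-reflexive (trans (sum-*ʳ (δ i) (f i)) (trans (cong (_* f i) (sum-δ)) (*-identityˡ (f i)))))
  where
  sum-δ : sumℚ (δ i) ≡ 1ℚ
  sum-δ = trans (sum-cong (λ k → ≡-sym (*-identityʳ (δ i k)))) (δ-sum i (λ _ → 1ℚ))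
  bound : ∀ k → f k ≤ δ i k * f i
  bound k with i F.≟ k
  ... | yes refl = ≤-reflexive (≡-sym (*-identityˡ (f k)))
  ... | no i≢k = ≤-trans (h k (λ eq → i≢k (≡-sym eq))) (≤-reflexive (≡-sym (*-zeroˡ (f i))))

sum-≤-two : ∀ {n} (f : Fin n → ℚ) a b → ¬ a ≡ b →
            (∀ k → ¬ k ≡ a → ¬ k ≡ b → f k ≤ 0ℚ) → sumℚ f ≤ f a + f b
sum-≤-two f a b a≢b h = begin
    sumℚ f          ≡⟨ solve 2 (λ s y → s := (s :- y) :+ y) refl (sumℚ f) (f b) ⟩
    sumℚ f - f b + f b ≡⟨ cong (_+ f b) (≡-sym sum-g) ⟩
    sumℚ g + f b    ≤⟨ +-monoˡ-≤ (f b) (sum-≤-point g a g≤0) ⟩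
    g a + f b       ≡⟨ cong (λ z → f a - z * f b + f b) (δ-off (λ eq → a≢b (≡-sym eq))) ⟩
    f a - 0ℚ * f b + f b ≡⟨ cong (_+ f b) (solve 2 (λ p q → p :- con 0ℚ :* q := p) refl (f a) (f b)) ⟩
    f a + f b       ∎
  where
  open ≤-Reasoning
  g : _ → ℚ
  g k = f k - δ b k * f b
  sum-g : sumℚ g ≡ sumℚ f - f b
  sum-g = trans (sum-+ f (λ k → - (δ b k * f b)))
    (cong (λ z → sumℚ f + z) (trans (sum-neg (λ k → δ b k * f b)) (cong -_ (δ-sum b (λ _ → f b)))))
  g≤0 : ∀ k → ¬ k ≡ a → g k ≤ 0ℚ
  g≤0 k k≢a with b F.≟ k
  ... | yes refl = ≤-reflexive (solve 1 (λ p → p :- con 1ℚ :* p := con 0ℚ) refl (f k))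
  ... | no b≢k = ≤-trans (≤-reflexive (solve 2 (λ p q → p :- con 0ℚ :* q := p) refl (f k) (f b)))
                         (h k k≢a (λ eq → b≢k (≡-sym eq)))

term-≤-sum : ∀ {n} (f : Fin n → ℚ) → (∀ k → 0ℚ ≤ f k) → ∀ b → f b ≤ sumℚ f
term-≤-sum f f≥0 b = ≤-trans (≤-reflexive (≡-sym (neg-involutive (f b))))
  (≤-trans (neg-antimono-≤ (≤-trans (≤-reflexive (≡-sym (sum-neg f)))
             (sum-≤-point (λ k → - f k) b (λ k _ → neg-antimono-≤ (f≥0 k)))))
    (≤-reflexive (neg-involutive (sumℚ f))))

two-≤-sum : ∀ {n} (f : Fin n → ℚ) a b → ¬ a ≡ b → (∀ k → 0ℚ ≤ f k) → f a + f b ≤ sumℚ f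
two-≤-sum f a b a≢b f≥0 = ≤-trans
  (≤-reflexive (solve 2 (λ p q → p :+ q := :- (:- p :+ :- q)) refl (f a) (f b)))
  (≤-trans (neg-antimono-≤ (≤-trans (≤-reflexive (≡-sym (sum-neg f)))
             (sum-≤-two (λ k → - f k) a b a≢b (λ k _ _ → neg-antimono-≤ (f≥0 k)))))
    (≤-reflexive (neg-involutive (sumℚ f))))

const-sum-zero : ∀ {m} (f : Fin (suc m) → ℚ) a → (∀ k → f k ≡ f a) → sumℚ f ≡ 0ℚ → f a ≡ 0ℚ
const-sum-zero {m} f a const sum≡0 = begin
    f a                                   ≡⟨ solve 3 (λ c y t → c := t :* (y :* c) :+ (con 1ℚ :- y :* t) :* c) refl (f a) n t ⟩
    t * (n * f a) + (1ℚ - n * t) * f a    ≡⟨ cong₂ (λ p q → t * p + (1ℚ - q) * f a) n·fa≡0 (ℕtoℚ-*-/ m 1) ⟩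
    t * 0ℚ + (1ℚ - 1ℚ) * f a              ≡⟨ solve 2 (λ t c → t :* con 0ℚ :+ (con 1ℚ :- con 1ℚ) :* c := con 0ℚ) refl t (f a) ⟩
    0ℚ                                    ∎
  where
  open ≡-Reasoning
  n t : ℚ
  n = ℕtoℚ (suc m)
  t = + 1 / suc m
  n·fa≡0 : n * f a ≡ 0ℚ
  n·fa≡0 = trans (≡-sym (sum-const {suc m} (f a))) (trans (≡-sym (sum-cong const)) sum≡0)

argmax : ∀ {m} (v : Fin (suc m) → ℚ) → Σ (Fin (suc m)) λ a → ∀ k → v k ≤ v a
argmax {ℕ.zero} v = zero , λ { zero → ≤-refl }
argmax {suc m} v with argmax (λ k → v (suc k))
... | a , h with v zero ≤? v (suc a)
... | yes le = suc a , λ { zero → le ; (suc k) → h k }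
... | no nle = zero , λ { zero → ≤-refl ; (suc k) → ≤-trans (h k) (<⇒≤ (≰⇒> nle)) }

argmin : ∀ {m} (v : Fin (suc m) → ℚ) → Σ (Fin (suc m)) λ a → ∀ k → v a ≤ v k
argmin v with argmax (λ k → - v k)
... | a , h = a , λ k → ≤-trans (≤-reflexive (≡-sym (neg-involutive (v a))))
                      (≤-trans (neg-antimono-≤ (h k)) (≤-reflexive (neg-involutive (v k))))

two-vertices : ∀ {m} (i j : Fin (suc m)) → ¬ i ≡ j → 0 < m
two-vertices {ℕ.zero} zero zero i≢j = ⊥-elim (i≢j refl)
two-vertices {suc m} _ _ _ = ℕ.s≤s ℕ.z≤n

maxFin-≥ : ∀ {m} (f : Fin (suc m) → ℚ) k → f k ≤ maxFin f
maxFin-≥ {ℕ.zero} f zero = ≤-refl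
maxFin-≥ {suc m} f zero = p≤p⊔q (f zero) _
maxFin-≥ {suc m} f (suc k) = p≤q⇒p≤r⊔q (f zero) (maxFin-≥ (λ j → f (suc j)) k)

sum-mask : ∀ {n} (p : Fin n → Bool) c → sumℚ (λ k → if p k then c else 0ℚ) ≡ ℕtoℚ (count p) * c
sum-mask {ℕ.zero} p c = ≡-sym (*-zeroˡ c)
sum-mask {suc n} p c = step (p zero) (sum-mask (λ k → p (suc k)) c)
  where
  step : ∀ b {S N} → S ≡ ℕtoℚ N * c →
         (if b then c else 0ℚ) + S ≡ ℕtoℚ ((if b then 1 else 0) ℕ.+ N) * c
  step true {S} {N} eq = trans (cong (λ z → c + z) eq)
    (trans (solve 2 (λ y c → c :+ y :* c := (con 1ℚ :+ y) :* c) refl (ℕtoℚ N) c)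
      (cong (_* c) (≡-sym (ℕtoℚ-suc N))))
  step false {S} eq = trans (+-identityˡ S) eq

count-compl : ∀ {n} (p : Fin n → Bool) → count p ℕ.+ count (λ k → not (p k)) ≡ n
count-compl {ℕ.zero} p = refl
count-compl {suc n} p = step (p zero) (count-compl (λ k → p (suc k)))
  where
  step : ∀ b {N M} → N ℕ.+ M ≡ n →
         (if b then 1 else 0) ℕ.+ N ℕ.+ ((if not b then 1 else 0) ℕ.+ M) ≡ suc n
  step true eq = cong suc eq
  step false {N} {M} eq = trans (ℕP.+-suc N M) (cong suc eq)

sum-split-mask : ∀ {n} (p : Fin n → Bool) (y : Fin n → ℚ) →
  sumℚ (λ k → if p k then y k else 0ℚ) + sumℚ (λ k → if p k then 0ℚ else y k) ≡ sumℚ y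
sum-split-mask p y = trans (≡-sym (sum-+ (λ k → if p k then y k else 0ℚ) (λ k → if p k then 0ℚ else y k)))
  (sum-cong split)
  where
  split : ∀ k → (if p k then y k else 0ℚ) + (if p k then 0ℚ else y k) ≡ y k
  split k with p k
  ... | true = +-identityʳ (y k)
  ... | false = +-identityˡ (y k)

module Laplacian {n : ℕ} (G : SimpleGraph n) where

  L : Matrix n
  L = laplacian G

  adjSum : Fin n → (Fin n → ℚ) → ℚ
  adjSum i v = sumℚ (λ k → if Adj G i k then v k else 0ℚ)

  L-sym : ∀ i k → L i k ≡ L k i
  L-sym i k with i F.≟ k | k F.≟ i
  ... | yes refl | yes _ = refl
  ... | yes eq | no k≢i = ⊥-elim (k≢i (≡-sym eq))
  ... | no i≢k | yes eq = ⊥-elim (i≢k (≡-sym eq))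
  ... | no _ | no _ = cong (λ b → if b then - ℕtoℚ 1 else 0ℚ) (SimpleGraph.sym G i k)

  L-row : ∀ i v → sumℚ (λ k → L i k * v k) ≡ ℕtoℚ (degree G i) * v i - adjSum i v
  L-row i v = begin
      sumℚ (λ k → L i k * v k)
    ≡⟨ sum-cong (λ k → solve 2 (λ a b → a := a :+ b :- b) refl (L i k * v k) (masked k)) ⟩
      sumℚ (λ k → diagPart k + - masked k)
    ≡⟨ sum-+ diagPart (λ k → - masked k) ⟩
      sumℚ diagPart + sumℚ (λ k → - masked k)
    ≡⟨ cong₂ _+_ (trans (sum-point diagPart i off-diag) on-diag) (sum-neg masked) ⟩
      ℕtoℚ (degree G i) * v i - adjSum i v
    ∎
    where
    open ≡-Reasoning
    masked : Fin n → ℚ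
    masked k = if Adj G i k then v k else 0ℚ
    -- L i k v k plus the neighbour term: only the diagonal survives
    diagPart : Fin n → ℚ
    diagPart k = L i k * v k + masked k
    off-diag : ∀ k → ¬ k ≡ i → diagPart k ≡ 0ℚ
    off-diag k k≢i with i F.≟ k
    ... | yes eq = ⊥-elim (k≢i (≡-sym eq))
    ... | no _ with Adj G i k
    ... | true = solve 1 (λ y → con (- 1ℚ) :* y :+ y := con 0ℚ) refl (v k)
    ... | false = trans (+-identityʳ _) (*-zeroˡ (v k))
    on-diag : diagPart i ≡ ℕtoℚ (degree G i) * v i
    on-diag with i F.≟ i
    ... | no i≢i = ⊥-elim (i≢i refl)
    ... | yes _ rewrite SimpleGraph.irrefl G i = +-identityʳ _

  adjSum-const : ∀ i c → adjSum i (λ _ → c) ≡ ℕtoℚ (degree G i) * c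
  adjSum-const i c = sum-mask (Adj G i) c

  L-rowsum : ∀ i → sumℚ (λ k → L i k) ≡ 0ℚ
  L-rowsum i = begin
      sumℚ (λ k → L i k)                      ≡⟨ sum-cong (λ k → ≡-sym (*-identityʳ (L i k))) ⟩
      sumℚ (λ k → L i k * 1ℚ)                 ≡⟨ L-row i (λ _ → 1ℚ) ⟩
      deg * 1ℚ - adjSum i (λ _ → 1ℚ)          ≡⟨ cong (λ z → deg * 1ℚ - z) (adjSum-const i 1ℚ) ⟩
      deg * 1ℚ - deg * 1ℚ                     ≡⟨ +-inverseʳ (deg * 1ℚ) ⟩
      0ℚ                                      ∎
    where
    open ≡-Reasoning
    deg = ℕtoℚ (degree G i)

  L-colsum : ∀ k → sumℚ (λ i → L i k) ≡ 0ℚ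
  L-colsum k = trans (sum-cong (λ i → L-sym i k)) (L-rowsum k)

open Laplacian using (adjSum; L-sym; L-row; adjSum-const; L-rowsum; L-colsum)

-- (1) L-harmonic vectors on a connected graph are constant

module Harmonic {m : ℕ} (G : SimpleGraph (suc m)) (v : Fin (suc m) → ℚ)
  (harmonic : ∀ i → sumℚ (λ k → laplacian G i k * v k) ≡ 0ℚ) where

  -- Maximum principle: a neighbour b of a maximiser a is a maximiser, since
  -- 0 = (L v)_a = Σ_{k∼a} (v_a − v_k) is a sum of nonnegative terms.
  max-spreads : ∀ a b → (∀ k → v k ≤ v a) → Adjacent G a b → v b ≡ v a
  max-spreads a b v≤va a∼b = ≤-antisym (v≤va b) (diff-nonPos⇒≤ (begin
      v a - v b  ≡⟨ ≡-sym gap-b ⟩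
      gap b      ≤⟨ term-≤-sum gap gap-nonNeg b ⟩
      sumℚ gap   ≡⟨ gap-sum ⟩
      0ℚ         ∎))
    where
    open ≤-Reasoning
    gap : Fin (suc m) → ℚ
    gap k = if Adj G a k then v a - v k else 0ℚ
    gap-nonNeg : ∀ k → 0ℚ ≤ gap k
    gap-nonNeg k with Adj G a k
    ... | true = ≤⇒diff-nonNeg (v≤va k)
    ... | false = ≤-refl
    gap-split : ∀ k → gap k ≡ (if Adj G a k then v a else 0ℚ) + - (if Adj G a k then v k else 0ℚ)
    gap-split k with Adj G a k
    ... | true = refl
    ... | false = refl
    gap-sum : sumℚ gap ≡ 0ℚ
    gap-sum = begin-equality
        sumℚ gap
      ≡⟨ trans (sum-cong gap-split) (sum-+ (λ k → if Adj G a k then v a else 0ℚ) (λ k → - (if Adj G a k then v k else 0ℚ))) ⟩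
        adjSum G a (λ _ → v a) + sumℚ (λ k → - (if Adj G a k then v k else 0ℚ))
      ≡⟨ cong₂ _+_ (adjSum-const G a (v a)) (sum-neg (λ k → if Adj G a k then v k else 0ℚ)) ⟩
        ℕtoℚ (degree G a) * v a - adjSum G a v
      ≡⟨ ≡-sym (L-row G a v) ⟩
        sumℚ (λ k → laplacian G a k * v k)
      ≡⟨ harmonic a ⟩
        0ℚ
      ∎
    gap-b : gap b ≡ v a - v b
    gap-b rewrite a∼b = refl

  max-walk : ∀ a b → (∀ k → v k ≤ v a) → Star (Adjacent G) a b → v b ≡ v a
  max-walk a .a _ ε = refl
  max-walk a b v≤va (_◅_ {j = c} a∼c walk) =
    trans (max-walk c b (λ k → ≤-trans (v≤va k) (≤-reflexive (≡-sym vc≡va))) walk) vc≡va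
    where
    vc≡va : v c ≡ v a
    vc≡va = max-spreads a c v≤va a∼c

  constant : Connected G → ∀ a b → v a ≡ v b
  constant connected a b with argmax v
  ... | top , v≤top = trans (max-walk top a v≤top (connected top a))
                            (≡-sym (max-walk top b v≤top (connected top b)))

-- (2) Consequences of the Moore–Penrose conditions for a Laplacian

module MoorePenrose {m : ℕ} (G : SimpleGraph (suc m)) (connected : Connected G)
  (X : Matrix (suc m)) (mp : IsMoorePenroseInverse (laplacian G) X) where

  private
    L : Matrix (suc m)
    L = laplacian G
    t : ℚ
    t = + 1 / suc m

    LXL≡L : ∀ i j → ((L · X) · L) i j ≡ L i j
    LXL≡L = proj₁ mp
    XLX≡X : ∀ i j → ((X · L) · X) i j ≡ X i j
    XLX≡X = proj₁ (proj₂ mp)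
    LX-sym : ∀ i j → (L · X) i j ≡ (L · X) j i
    LX-sym = proj₁ (proj₂ (proj₂ mp))
    XL-sym : ∀ i j → (X · L) i j ≡ (X · L) j i
    XL-sym = proj₂ (proj₂ (proj₂ mp))

  -- L X has zero column sums because L does, hence zero row sums by symmetry.
  LX-colsum : ∀ k → sumℚ (λ i → (L · X) i k) ≡ 0ℚ
  LX-colsum k = trans (sum-swap (λ i l → L i l * X l k)) (sum-zero _ (λ l →
    trans (sum-*ʳ (λ i → L i l) (X l k)) (trans (cong (_* X l k) (L-colsum G l)) (*-zeroˡ (X l k)))))

  LX-rowsum : ∀ i → sumℚ (λ k → (L · X) i k) ≡ 0ℚ
  LX-rowsum i = trans (sum-cong (λ k → LX-sym i k)) (LX-colsum i)

  -- the defect of L X from the projection I − J/n onto the complement of 𝟙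
  defect : Fin (suc m) → Fin (suc m) → ℚ
  defect i k = δ i k - t - (L · X) i k

  -- Each row of the defect is L-harmonic, as L is symmetric and
  -- (I − J/n − L X) L = L − 0 − L X L = 0.
  defect-harmonic : ∀ i j → sumℚ (λ k → L j k * defect i k) ≡ 0ℚ
  defect-harmonic i j = begin
      sumℚ (λ k → L j k * defect i k)
    ≡⟨ sum-cong (λ k → trans (cong (_* defect i k) (L-sym G j k))
         (solve 4 (λ l e t p → l :* (e :- t :- p) := e :* l :+ (:- t) :* l :+ :- (p :* l)) refl
            (L k j) (δ i k) t ((L · X) i k))) ⟩
      sumℚ (λ k → δ i k * L k j + (- t) * L k j + - ((L · X) i k * L k j))
    ≡⟨ trans (sum-+ (λ k → δ i k * L k j + (- t) * L k j) (λ k → - ((L · X) i k * L k j)))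
         (cong₂ _+_ (sum-+ (λ k → δ i k * L k j) (λ k → (- t) * L k j)) (sum-neg (λ k → (L · X) i k * L k j))) ⟩
      sumℚ (λ k → δ i k * L k j) + sumℚ (λ k → (- t) * L k j) + - ((L · X) · L) i j
    ≡⟨ cong₂ _+_ (cong₂ _+_ (δ-sum i (λ k → L k j))
         (trans (sum-*ˡ (- t) (λ k → L k j)) (trans (cong ((- t) *_) (L-colsum G j)) (*-zeroʳ (- t)))))
         (cong -_ (LXL≡L i j)) ⟩
      L i j + 0ℚ + - L i j
    ≡⟨ solve 1 (λ y → y :+ con 0ℚ :+ :- y := con 0ℚ) refl (L i j) ⟩
      0ℚ
    ∎
    where open ≡-Reasoning

  defect-sum : ∀ i → sumℚ (defect i) ≡ 0ℚ
  defect-sum i = begin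
      sumℚ (defect i)
    ≡⟨ sum-cong (λ k → solve 3 (λ e t p → e :- t :- p := e :* con 1ℚ :+ :- t :+ :- p) refl (δ i k) t ((L · X) i k)) ⟩
      sumℚ (λ k → δ i k * 1ℚ + - t + - (L · X) i k)
    ≡⟨ trans (sum-+ (λ k → δ i k * 1ℚ + - t) (λ k → - (L · X) i k))
         (cong₂ _+_ (sum-+ (λ k → δ i k * 1ℚ) (λ _ → - t)) (sum-neg (λ k → (L · X) i k))) ⟩
      sumℚ (λ k → δ i k * 1ℚ) + sumℚ {suc m} (λ _ → - t) + - sumℚ (λ k → (L · X) i k)
    ≡⟨ cong₂ _+_ (cong₂ _+_ (δ-sum i (λ _ → 1ℚ)) (sum-const {suc m} (- t))) (cong -_ (LX-rowsum i)) ⟩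
      1ℚ + ℕtoℚ (suc m) * (- t) + - 0ℚ
    ≡⟨ solve 2 (λ a t → con 1ℚ :+ a :* (:- t) :+ :- con 0ℚ := con 1ℚ :- a :* t) refl (ℕtoℚ (suc m)) t ⟩
      1ℚ - ℕtoℚ (suc m) * t
    ≡⟨ cong (λ z → 1ℚ - z) (ℕtoℚ-*-/ m 1) ⟩
      0ℚ
    ∎
    where open ≡-Reasoning

  -- L X = I − J/n: the defect rows are constant (connectedness) with zero sum.
  LX≡ : ∀ i k → (L · X) i k ≡ δ i k - t
  LX≡ i k = begin
      (L · X) i k                          ≡⟨ solve 3 (λ p e t → p := e :- t :- (e :- t :- p)) refl ((L · X) i k) (δ i k) t ⟩
      δ i k - t - defect i k               ≡⟨ cong (λ z → δ i k - t - z) defect≡0 ⟩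
      δ i k - t - 0ℚ                       ≡⟨ solve 2 (λ e t → e :- t :- con 0ℚ := e :- t) refl (δ i k) t ⟩
      δ i k - t                            ∎
    where
    open ≡-Reasoning
    defect≡0 : defect i k ≡ 0ℚ
    defect≡0 = const-sum-zero (defect i) k
      (λ l → Harmonic.constant G (defect i) (defect-harmonic i) connected l k) (defect-sum i)

  -- X has zero column sums: X = (X L) X and X L has zero column sums
  -- (it is symmetric and L has zero row sums).
  X-colsum : ∀ j → sumℚ (λ i → X i j) ≡ 0ℚ
  X-colsum j = begin
      sumℚ (λ i → X i j)
    ≡⟨ sum-cong (λ i → ≡-sym (XLX≡X i j)) ⟩
      sumℚ (λ i → sumℚ (λ k → (X · L) i k * X k j))
    ≡⟨ sum-swap (λ i k → (X · L) i k * X k j) ⟩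
      sumℚ (λ k → sumℚ (λ i → (X · L) i k * X k j))
    ≡⟨ sum-zero _ (λ k → trans (sum-*ʳ (λ i → (X · L) i k) (X k j))
         (trans (cong (_* X k j) (XL-colsum k)) (*-zeroˡ (X k j)))) ⟩
      0ℚ
    ∎
    where
    open ≡-Reasoning
    XL-colsum : ∀ k → sumℚ (λ i → (X · L) i k) ≡ 0ℚ
    XL-colsum k = trans (sum-cong (λ i → XL-sym i k)) (trans (sum-swap (λ i l → X k l * L l i))
      (sum-zero _ (λ l → trans (sum-*ˡ (X k l) (λ i → L l i)) (trans (cong (X k l *_) (L-rowsum G l)) (*-zeroʳ (X k l))))))

-- (3) One column of L⁺ in a dense regular graph

-- Throughout t = 1/n, κ = 2d + 2 − n ≥ 1 and c = d + 2 − κ = n − d is the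
-- number of non-neighbours of a vertex (the vertex itself included).
module ColumnBound {m d : ℕ} (G : SimpleGraph (suc m)) (regular : IsRegular G d)
  (dense : suc m < 2 ℕ.* d ℕ.+ 2) (j : Fin (suc m)) (x : Fin (suc m) → ℚ)
  (x-sum : sumℚ x ≡ 0ℚ)
  (x-eq : ∀ i → sumℚ (λ k → laplacian G i k * x k) ≡ δ i j - + 1 / suc m) where

  n t dq two κ c D u η : ℚ
  n = ℕtoℚ (suc m)
  t = + 1 / suc m
  dq = ℕtoℚ d
  two = 1ℚ + 1ℚ
  κ = ℕtoℚ (2 ℕ.* d ℕ.+ 2 ∸ suc m)
  c = dq + two - κ
  D = dq + 1ℚ
  u = + 1 / suc (2 ℕ.* d ℕ.+ 2 ∸ suc m)
  η = + 2 / (suc m ℕ.* suc m)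

  n-pos : 0ℚ Q.< n
  n-pos = ℕtoℚ-pos {suc m} (ℕ.s≤s ℕ.z≤n)

  t-pos : 0ℚ Q.< t
  t-pos = positive⁻¹ t {{normalize-pos 1 (suc m)}}

  κ-pos : 0ℚ Q.< κ
  κ-pos = ℕtoℚ-pos (ℕP.m<n⇒0<n∸m dense)

  D-pos : 0ℚ Q.< D
  D-pos = ≤-<-trans (≤-reflexive (≡-sym (+-identityʳ 0ℚ))) (+-mono-≤-< (ℕtoℚ-nonNeg d) 0<1)

  n·t≡1 : n * t ≡ 1ℚ
  n·t≡1 = ℕtoℚ-*-/ m 1

  n+κ : n + κ ≡ dq + dq + two
  n+κ = begin
      n + κ                              ≡⟨ ≡-sym (ℕtoℚ-+ (suc m) _) ⟩
      ℕtoℚ (suc m ℕ.+ (2 ℕ.* d ℕ.+ 2 ∸ suc m)) ≡⟨ cong ℕtoℚ (ℕP.m+[n∸m]≡n (ℕP.<⇒≤ dense)) ⟩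
      ℕtoℚ (2 ℕ.* d ℕ.+ 2)               ≡⟨ trans (ℕtoℚ-+ (2 ℕ.* d) 2) (cong₂ _+_ (ℕtoℚ-* 2 d) (ℕtoℚ-suc 1)) ⟩
      ℕtoℚ 2 * dq + two                  ≡⟨ cong (λ z → z * dq + two) (ℕtoℚ-suc 1) ⟩
      two * dq + two                     ≡⟨ solve 1 (λ y → (con 1ℚ :+ con 1ℚ) :* y :+ (con 1ℚ :+ con 1ℚ)
                                                 := y :+ y :+ (con 1ℚ :+ con 1ℚ)) refl dq ⟩
      dq + dq + two                      ∎
    where open ≡-Reasoning

  d+c≡n : dq + c ≡ n
  d+c≡n = trans (solve 3 (λ y k a → y :+ (y :+ a :- k) := (y :+ y :+ a) :- k) refl dq κ two)
    (trans (cong (_- κ) (≡-sym n+κ)) (solve 2 (λ y k → y :+ k :- k := y) refl n κ))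

  [d+c]t≡1 : (dq + c) * t ≡ 1ℚ
  [d+c]t≡1 = trans (cong (_* t) d+c≡n) n·t≡1

  [1+κ]u≡1 : (1ℚ + κ) * u ≡ 1ℚ
  [1+κ]u≡1 = trans (cong (_* u) (≡-sym (ℕtoℚ-suc kN))) (ℕtoℚ-*-/ kN 1)
    where kN = 2 ℕ.* d ℕ.+ 2 ∸ suc m

  η≡2t² : η ≡ two * t * t
  η≡2t² = begin
      η
    ≡⟨ solve 3 (λ a t e → e := t :* t :* (a :* a :* e) :+ (con 1ℚ :- (a :* t) :* (a :* t)) :* e) refl n t η ⟩
      t * t * (n * n * η) + (1ℚ - (n * t) * (n * t)) * η
    ≡⟨ cong₂ (λ p z → t * t * (p * η) + (1ℚ - z * z) * η) (≡-sym (ℕtoℚ-* (suc m) (suc m))) n·t≡1 ⟩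
      t * t * (ℕtoℚ (suc m ℕ.* suc m) * η) + (1ℚ - 1ℚ * 1ℚ) * η
    ≡⟨ cong (λ z → t * t * z + (1ℚ - 1ℚ * 1ℚ) * η) (trans (ℕtoℚ-*-/ (m ℕ.+ m ℕ.* suc m) 2) (ℕtoℚ-suc 1)) ⟩
      t * t * two + (1ℚ - 1ℚ * 1ℚ) * η
    ≡⟨ solve 2 (λ t e → t :* t :* (con 1ℚ :+ con 1ℚ) :+ (con 1ℚ :- con 1ℚ :* con 1ℚ) :* e
                      := (con 1ℚ :+ con 1ℚ) :* t :* t) refl t η ⟩
      two * t * t
    ∎
    where open ≡-Reasoning

  -- sum of y over the non-neighbours of i (i itself included)
  nonAdj : Fin (suc m) → (Fin (suc m) → ℚ) → ℚ
  nonAdj i y = sumℚ (λ k → if Adj G i k then 0ℚ else y k)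

  nonAdj-const : ∀ i a → nonAdj i (λ _ → a) ≡ c * a
  nonAdj-const i a = begin
      nonAdj i (λ _ → a)                          ≡⟨ sum-cong flip-mask ⟩
      sumℚ (λ k → if not (Adj G i k) then a else 0ℚ) ≡⟨ sum-mask (λ k → not (Adj G i k)) a ⟩
      ℕtoℚ nonAdjCount * a                        ≡⟨ cong (_* a) count≡c ⟩
      c * a                                       ∎
    where
    open ≡-Reasoning
    nonAdjCount : ℕ
    nonAdjCount = count (λ k → not (Adj G i k))
    flip-mask : ∀ k → (if Adj G i k then 0ℚ else a) ≡ (if not (Adj G i k) then a else 0ℚ)
    flip-mask k with Adj G i k
    ... | true = refl
    ... | false = refl
    -- d + #non-neighbours = n = d + c
    count≡c : ℕtoℚ nonAdjCount ≡ c
    count≡c = begin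
        ℕtoℚ nonAdjCount                        ≡⟨ solve 2 (λ y p → p := y :+ p :- y) refl dq _ ⟩
        dq + ℕtoℚ nonAdjCount - dq              ≡⟨ cong (λ z → ℕtoℚ z + ℕtoℚ nonAdjCount - dq) (≡-sym (regular i)) ⟩
        ℕtoℚ (degree G i) + ℕtoℚ nonAdjCount - dq ≡⟨ cong (_- dq) (trans (≡-sym (ℕtoℚ-+ (degree G i) nonAdjCount)) (cong ℕtoℚ (count-compl (Adj G i)))) ⟩
        n - dq                                  ≡⟨ cong (_- dq) (≡-sym d+c≡n) ⟩
        dq + c - dq                             ≡⟨ solve 2 (λ y p → y :+ p :- y := p) refl dq c ⟩
        c                                       ∎

  nonAdj-+ : ∀ i y z → nonAdj i (λ k → y k + z k) ≡ nonAdj i y + nonAdj i z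
  nonAdj-+ i y z = trans (sum-cong split) (sum-+ (λ k → if Adj G i k then 0ℚ else y k) (λ k → if Adj G i k then 0ℚ else z k))
    where
    split : ∀ k → (if Adj G i k then 0ℚ else (y k + z k)) ≡ (if Adj G i k then 0ℚ else y k) + (if Adj G i k then 0ℚ else z k)
    split k with Adj G i k
    ... | true = ≡-sym (+-identityˡ 0ℚ)
    ... | false = refl

  nonAdj-* : ∀ i a y → nonAdj i (λ k → a * y k) ≡ a * nonAdj i y
  nonAdj-* i a y = trans (sum-cong scale) (sum-*ˡ a (λ k → if Adj G i k then 0ℚ else y k))
    where
    scale : ∀ k → (if Adj G i k then 0ℚ else (a * y k)) ≡ a * (if Adj G i k then 0ℚ else y k)
    scale k with Adj G i k
    ... | true = ≡-sym (*-zeroʳ a)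
    ... | false = refl

  -- The row equations: d x_i − Σ_{k∼i} x_k = δ_ij − t, and, since Σ x = 0,
  -- equivalently d x_i + Σ_{k≁i} x_k = δ_ij − t.
  balance-adj : ∀ i → dq * x i - adjSum G i x ≡ δ i j - t
  balance-adj i = trans (cong (λ z → ℕtoℚ z * x i - adjSum G i x) (≡-sym (regular i)))
                        (trans (≡-sym (L-row G i x)) (x-eq i))

  balance : ∀ i → dq * x i + nonAdj i x ≡ δ i j - t
  balance i = trans (cong (λ z → dq * x i + z) nonAdj≡-adj) (balance-adj i)
    where
    nonAdj≡-adj : nonAdj i x ≡ - adjSum G i x
    nonAdj≡-adj = trans (solve 2 (λ a p → p := :- a :+ (a :+ p)) refl (adjSum G i x) (nonAdj i x))
      (trans (cong (λ z → - adjSum G i x + z) (trans (sum-split-mask (Adj G i) x) x-sum)) (+-identityʳ _))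

  balance-off : ∀ i → ¬ i ≡ j → dq * x i + nonAdj i x ≡ 0ℚ - t
  balance-off i i≢j = trans (balance i) (cong (_- t) (δ-off i≢j))

  adjSum-≤ : ∀ i b → (∀ k → x k ≤ b) → adjSum G i x ≤ dq * b
  adjSum-≤ i b x≤b = ≤-trans (sum-mono masked)
    (≤-reflexive (trans (adjSum-const G i b) (cong (λ z → ℕtoℚ z * b) (regular i))))
    where
    masked : ∀ k → (if Adj G i k then x k else 0ℚ) ≤ (if Adj G i k then b else 0ℚ)
    masked k with Adj G i k
    ... | true = x≤b k
    ... | false = ≤-refl

  adjSum-≥ : ∀ i b → (∀ k → b ≤ x k) → dq * b ≤ adjSum G i x
  adjSum-≥ i b b≤x = ≤-trans
    (≤-reflexive (≡-sym (trans (adjSum-const G i b) (cong (λ z → ℕtoℚ z * b) (regular i)))))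
    (sum-mono masked)
    where
    masked : ∀ k → (if Adj G i k then b else 0ℚ) ≤ (if Adj G i k then x k else 0ℚ)
    masked k with Adj G i k
    ... | true = b≤x k
    ... | false = ≤-refl

  -- x is maximal at j: at a maximiser a, 0 ≤ d x_a − Σ_{k∼a} x_k = δ_aj − t.
  x≤xj : ∀ k → x k ≤ x j
  x≤xj k with argmax x
  ... | a , x≤xa with a F.≟ j
  ...   | yes refl = x≤xa k
  ...   | no a≢j = ⊥-elim (<-irrefl refl (<-≤-trans t-pos (diff-nonNeg⇒≤ (≤-trans
            (≤⇒diff-nonNeg (adjSum-≤ a (x a) x≤xa))
            (≤-reflexive (trans (balance-adj a) (cong (_- t) (δ-off a≢j))))))))

  -- Zero sum forces max x ≥ 0 ≥ min x.
  xj-nonNeg : 0ℚ ≤ x j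
  xj-nonNeg = cancel-≤ n n-pos (begin
      n * 0ℚ                   ≡⟨ *-zeroʳ n ⟩
      0ℚ                       ≡⟨ ≡-sym x-sum ⟩
      sumℚ x                   ≤⟨ sum-mono x≤xj ⟩
      sumℚ {suc m} (λ _ → x j) ≡⟨ sum-const {suc m} (x j) ⟩
      n * x j                  ∎)
    where open ≤-Reasoning

  i₀ : Fin (suc m)
  i₀ = proj₁ (argmin x)

  w Q : ℚ
  w = x i₀
  Q = - w

  w≤x : ∀ k → w ≤ x k
  w≤x = proj₂ (argmin x)

  Q-nonNeg : 0ℚ ≤ Q
  Q-nonNeg = neg-antimono-≤ (cancel-≤ n n-pos (begin
      n * w                    ≡⟨ ≡-sym (sum-const {suc m} w) ⟩
      sumℚ {suc m} (λ _ → w)   ≤⟨ sum-mono w≤x ⟩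
      sumℚ x                   ≡⟨ x-sum ⟩
      0ℚ                       ≡⟨ ≡-sym (*-zeroʳ n) ⟩
      n * 0ℚ                   ∎))
    where open ≤-Reasoning

  -x≤Q : ∀ k → - x k ≤ Q
  -x≤Q k = neg-antimono-≤ (w≤x k)

  -- Off column j the values are bounded above in terms of Q:
  -- (d + 1) x_k ≤ V := −t + (c − 1) Q, because each of the c non-neighbours
  -- of k other than k itself contributes at least −Q to the balance at k.
  V : ℚ
  V = - t + (c - 1ℚ) * Q

  offColumn-≤ : ∀ k → ¬ k ≡ j → D * x k ≤ V
  offColumn-≤ k k≢j = ≤-by-certificate 1ℚ 0ℚ ((0ℚ - t) - (dq * x k + nonAdj k x))
      {x k + Q} {nonAdj k x + c * Q} xk+Q≤ 0≤1 ≤-refl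
      (trans (cong (λ z → (0ℚ - t) - z) (balance-off k k≢j)) (+-inverseʳ (0ℚ - t)))
      (solve 6 (λ t c q dd xk s → (:- t :+ (c :- con 1ℚ) :* q) :- (dd :+ con 1ℚ) :* xk
          := con 1ℚ :* ((s :+ c :* q) :- (xk :+ q)) :+ con 0ℚ :+ ((con 0ℚ :- t) :- (dd :* xk :+ s)))
        refl t c Q dq (x k) (nonAdj k x))
    where
    shifted : Fin (suc m) → ℚ
    shifted l = if Adj G k l then 0ℚ else (x l + Q)
    shifted-nonNeg : ∀ l → 0ℚ ≤ shifted l
    shifted-nonNeg l with Adj G k l
    ... | true = ≤-refl
    ... | false = ≤-trans (≤⇒diff-nonNeg (-x≤Q l)) (≤-reflexive (solve 2 (λ a b → b :- (:- a) := a :+ b) refl (x l) Q))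
    shifted-k : shifted k ≡ x k + Q
    shifted-k rewrite SimpleGraph.irrefl G k = refl
    xk+Q≤ : x k + Q ≤ nonAdj k x + c * Q
    xk+Q≤ = ≤-trans (≤-reflexive (≡-sym shifted-k)) (≤-trans (term-≤-sum shifted shifted-nonNeg k)
      (≤-reflexive (trans (nonAdj-+ k x (λ _ → Q)) (cong (λ z → nonAdj k x + z) (nonAdj-const k Q)))))

  -- Since x_i ≥ −Q, this gives |x_i| ≤ Q off column j (as c − 1 ≤ d + 1).
  offColumn-∣∣≤ : ∀ i → ¬ i ≡ j → ∣ x i ∣ ≤ Q
  offColumn-∣∣≤ i i≢j = ∣∣-≤ (cancel-≤ D D-pos (≤-trans (offColumn-≤ i i≢j)
      (≤-by-certificate 1ℚ (t + κ * Q) 0ℚ {0ℚ} {0ℚ} ≤-refl 0≤1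
        (+-nonNeg (<⇒≤ t-pos) (*-nonNeg (<⇒≤ κ-pos) Q-nonNeg)) refl
        (solve 4 (λ t k y w → (y :+ con 1ℚ) :* (:- w) :- (:- t :+ (y :+ (con 1ℚ :+ con 1ℚ) :- k :- con 1ℚ) :* (:- w))
            := con 1ℚ :* (con 0ℚ :- con 0ℚ) :+ (t :+ k :* (:- w)) :+ con 0ℚ) refl t κ dq w))))
    (-x≤Q i)

  -- With two distinct vertices, the minimum is not attained at j: otherwise
  -- d x_j ≤ Σ_{k∼j} x_k, i.e. 1 − t ≤ 0, while 1 − t = m t > 0.
  argmin-off-column : ∀ {i} → ¬ i ≡ j → ¬ i₀ ≡ j
  argmin-off-column {i} i≢j i₀≡j = <-irrefl refl (<-≤-trans 0<1-t 1-t≤0)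
    where
    0<1-t : 0ℚ Q.< 1ℚ - t
    0<1-t = <-≤-trans (*-pos (ℕtoℚ-pos (two-vertices i j i≢j)) t-pos) (≤-reflexive (begin-equality
        ℕtoℚ m * t                  ≡⟨ solve 2 (λ y t → y :* t := con 1ℚ :- t :- (con 1ℚ :- (con 1ℚ :+ y) :* t)) refl (ℕtoℚ m) t ⟩
        1ℚ - t - (1ℚ - (1ℚ + ℕtoℚ m) * t) ≡⟨ cong (λ z → 1ℚ - t - (1ℚ - z * t)) (≡-sym (ℕtoℚ-suc m)) ⟩
        1ℚ - t - (1ℚ - n * t)       ≡⟨ cong (λ z → 1ℚ - t - (1ℚ - z)) n·t≡1 ⟩
        1ℚ - t - (1ℚ - 1ℚ)          ≡⟨ solve 1 (λ t → con 1ℚ :- t :- (con 1ℚ :- con 1ℚ) := con 1ℚ :- t) refl t ⟩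
        1ℚ - t                      ∎))
      where open ≤-Reasoning
    1-t≤0 : 1ℚ - t ≤ 0ℚ
    1-t≤0 = begin
        1ℚ - t                      ≡⟨ cong (_- t) (≡-sym (δ-diag j)) ⟩
        δ j j - t                   ≡⟨ ≡-sym (balance-adj j) ⟩
        dq * x j - adjSum G j x     ≤⟨ ≤⇒diff-nonPos (adjSum-≥ j (x j) (λ k → subst (λ z → x z ≤ x k) i₀≡j (w≤x k))) ⟩
        0ℚ                          ∎
      where open ≤-Reasoning

  -- The quantities c, D, V and the balance defect at i₀ as solver
  -- polynomials in t, κ, d, w (= −Q) and s (= Σ_{k≁i₀} x_k).
  private
    2ᴾ : ∀ {k} → Polynomial k
    2ᴾ = con 1ℚ :+ con 1ℚ
    cᴾ : ∀ {k} → Polynomial k → Polynomial k → Polynomial k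
    cᴾ y κ = y :+ 2ᴾ :- κ
    Dᴾ : ∀ {k} → Polynomial k → Polynomial k
    Dᴾ y = y :+ con 1ℚ
    Vᴾ : ∀ {k} → (t κ y w : Polynomial k) → Polynomial k
    Vᴾ t κ y w = :- t :+ (cᴾ y κ :- con 1ℚ) :* (:- w)
    Zᴾ : ∀ {k} → (t y w s : Polynomial k) → Polynomial k
    Zᴾ t y w s = (y :* w :+ s) :- (con 0ℚ :- t)

  -- Q ≤ x_j/(κ+1) + 2t², from the balance at the minimiser i₀ ≠ j.
  module AtMinimum (i₀≢j : ¬ i₀ ≡ j) where

    g : Fin (suc m) → ℚ
    g l = if Adj G i₀ l then 0ℚ else (D * x l - V)

    g-nonPos : ∀ l → ¬ l ≡ i₀ → ¬ l ≡ j → g l ≤ 0ℚ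
    g-nonPos l _ l≢j with Adj G i₀ l
    ... | true = ≤-refl
    ... | false = ≤⇒diff-nonPos (offColumn-≤ l l≢j)

    g-i₀ : g i₀ ≡ D * w - V
    g-i₀ rewrite SimpleGraph.irrefl G i₀ = refl

    g-sum : D * nonAdj i₀ x + c * (- V) ≤ (D * w - V) + g j
    g-sum = begin
        D * nonAdj i₀ x + c * (- V) ≡⟨ ≡-sym (trans (nonAdj-+ i₀ (λ l → D * x l) (λ _ → - V))
                                                    (cong₂ _+_ (nonAdj-* i₀ D x) (nonAdj-const i₀ (- V)))) ⟩
        sumℚ g                      ≤⟨ sum-≤-two g i₀ j i₀≢j g-nonPos ⟩
        g i₀ + g j                  ≡⟨ cong (_+ g j) g-i₀ ⟩
        (D * w - V) + g j           ∎
      where open ≤-Reasoning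

    -- the balance at i₀, scaled by D, as a vanishing quantity for the certificates
    Z : ℚ
    Z = (dq * w + nonAdj i₀ x) - (0ℚ - t)

    D·Z≡0 : D * Z ≡ 0ℚ
    D·Z≡0 = trans (cong (λ z → D * (z - (0ℚ - t))) (balance-off i₀ i₀≢j))
                  (trans (cong (D *_) (+-inverseʳ (0ℚ - t))) (*-zeroʳ D))

    [d+c]t-1≡0 : ∀ q → q * ((dq + c) * t - 1ℚ) ≡ 0ℚ
    [d+c]t-1≡0 q = trans (cong (λ z → q * (z - 1ℚ)) [d+c]t≡1) (trans (cong (q *_) (+-inverseʳ 1ℚ)) (*-zeroʳ q))

    t-nonNeg : 0ℚ ≤ t
    t-nonNeg = <⇒≤ t-pos

    u-pos : 0ℚ Q.< u
    u-pos = positive⁻¹ u {{normalize-pos 1 (suc (2 ℕ.* d ℕ.+ 2 ∸ suc m))}}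

    -- If j ∼ i₀ then g j = 0 and the estimate gives κ n Q ≤ κ t, i.e. Q ≤ t².
    Q-≤-adjacent : Adj G i₀ j ≡ true → Q ≤ x j * u + two * t * t
    Q-≤-adjacent adj = ≤-by-certificate t (x j * u + t * t) (Q * ((dq + c) * t - 1ℚ)) [d+c]Q≤t t-nonNeg
        (+-nonNeg (*-nonNeg xj-nonNeg (<⇒≤ u-pos)) (*-nonNeg t-nonNeg t-nonNeg)) ([d+c]t-1≡0 Q)
        (solve 7 (λ t k y w s f u → f :* u :+ 2ᴾ :* t :* t :- (:- w)
            := t :* (t :- (y :+ cᴾ y k) :* (:- w)) :+ (f :* u :+ t :* t) :+ (:- w) :* ((y :+ cᴾ y k) :* t :- con 1ℚ))
          refl t κ dq w (nonAdj i₀ x) (x j) u)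
      where
      g-j : g j ≡ 0ℚ
      g-j rewrite adj = refl
      κ[d+c]Q≤κt : κ * ((dq + c) * Q) ≤ κ * t
      κ[d+c]Q≤κt = ≤-by-certificate 1ℚ 0ℚ (D * Z) (≤-trans g-sum (≤-reflexive (cong (λ z → D * w - V + z) g-j))) 0≤1 ≤-refl D·Z≡0
        (solve 5 (λ t k y w s → k :* t :- k :* ((y :+ cᴾ y k) :* (:- w))
            := con 1ℚ :* ((Dᴾ y :* w :+ :- Vᴾ t k y w :+ con 0ℚ) :- (Dᴾ y :* s :+ cᴾ y k :* (:- Vᴾ t k y w)))
               :+ con 0ℚ :+ Dᴾ y :* Zᴾ t y w s)
          refl t κ dq w (nonAdj i₀ x))
      [d+c]Q≤t : (dq + c) * Q ≤ t
      [d+c]Q≤t = cancel-≤ κ κ-pos κ[d+c]Q≤κt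

    -- If j ≁ i₀ then g j = D x_j − V; using c ≥ 2 the estimate gives
    -- (d+1)(κ+1) Q ≤ (κ+1) t + (d+1) x_j, and t/(d+1) ≤ 2t² as n ≤ 2d + 2.
    Q-≤-nonAdjacent : Adj G i₀ j ≡ false → Q ≤ x j * u + two * t * t
    Q-≤-nonAdjacent nonadj = cancel-≤ (D * (1ℚ + κ)) (*-pos D-pos 1+κ-pos) scaled
      where
      1+κ-pos : 0ℚ Q.< 1ℚ + κ
      1+κ-pos = ≤-<-trans (≤-reflexive (≡-sym (+-identityʳ 0ℚ))) (+-mono-≤-< 0≤1 κ-pos)
      g-j : g j ≡ D * x j - V
      g-j rewrite nonadj = refl
      -- c ≥ 2 since i₀ and j are both non-neighbours of i₀
      nonNeighbour : Fin (suc m) → ℚ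
      nonNeighbour l = if Adj G i₀ l then 0ℚ else 1ℚ
      two≤c : two ≤ c
      two≤c = ≤-trans (≤-reflexive (≡-sym (cong₂ _+_ at-i₀ at-j)))
        (≤-trans (two-≤-sum nonNeighbour i₀ j i₀≢j nonNeg) (≤-reflexive (trans (nonAdj-const i₀ 1ℚ) (*-identityʳ c))))
        where
        nonNeg : ∀ l → 0ℚ ≤ nonNeighbour l
        nonNeg l with Adj G i₀ l
        ... | true = ≤-refl
        ... | false = 0≤1
        at-i₀ : nonNeighbour i₀ ≡ 1ℚ
        at-i₀ rewrite SimpleGraph.irrefl G i₀ = refl
        at-j : nonNeighbour j ≡ 1ℚ
        at-j rewrite nonadj = refl
      step₁ : Q * (D * D - (c - 1ℚ) * (c - 1ℚ) + (c - 1ℚ)) ≤ (1ℚ + κ) * t + D * x j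
      step₁ = ≤-by-certificate 1ℚ 0ℚ (D * Z) (≤-trans g-sum (≤-reflexive (cong (λ z → D * w - V + z) g-j))) 0≤1 ≤-refl D·Z≡0
        (solve 6 (λ t k y w s f → (con 1ℚ :+ k) :* t :+ Dᴾ y :* f
              :- (:- w) :* (Dᴾ y :* Dᴾ y :- (cᴾ y k :- con 1ℚ) :* (cᴾ y k :- con 1ℚ) :+ (cᴾ y k :- con 1ℚ))
            := con 1ℚ :* (((Dᴾ y :* w :+ :- Vᴾ t k y w) :+ (Dᴾ y :* f :+ :- Vᴾ t k y w))
                 :- (Dᴾ y :* s :+ cᴾ y k :* (:- Vᴾ t k y w))) :+ con 0ℚ :+ Dᴾ y :* Zᴾ t y w s)
          refl t κ dq w (nonAdj i₀ x) (x j))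
      step₂ : Q * D * (1ℚ + κ) ≤ (1ℚ + κ) * t + D * x j
      step₂ = ≤-by-certificate 1ℚ (Q * ((c - two) * κ)) 0ℚ step₁ 0≤1
        (*-nonNeg Q-nonNeg (*-nonNeg (≤⇒diff-nonNeg two≤c) (<⇒≤ κ-pos))) refl
        (solve 6 (λ t k y w s f → (con 1ℚ :+ k) :* t :+ Dᴾ y :* f :- (:- w) :* Dᴾ y :* (con 1ℚ :+ k)
            := con 1ℚ :* (((con 1ℚ :+ k) :* t :+ Dᴾ y :* f)
                 :- (:- w) :* (Dᴾ y :* Dᴾ y :- (cᴾ y k :- con 1ℚ) :* (cᴾ y k :- con 1ℚ) :+ (cᴾ y k :- con 1ℚ)))
               :+ (:- w) :* ((cᴾ y k :- 2ᴾ) :* k) :+ con 0ℚ)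
          refl t κ dq w (nonAdj i₀ x) (x j))
      vanishing : D * x j * ((1ℚ + κ) * u - 1ℚ) + (1ℚ + κ) * t * ((dq + c) * t - 1ℚ) ≡ 0ℚ
      vanishing = trans (cong₂ _+_
          (trans (cong (λ z → D * x j * (z - 1ℚ)) [1+κ]u≡1) (trans (cong (D * x j *_) (+-inverseʳ 1ℚ)) (*-zeroʳ (D * x j))))
          ([d+c]t-1≡0 ((1ℚ + κ) * t))) (+-identityʳ 0ℚ)
      scaled : D * (1ℚ + κ) * Q ≤ D * (1ℚ + κ) * (x j * u + two * t * t)
      scaled = ≤-by-certificate 1ℚ ((1ℚ + κ) * t * t * κ) (D * x j * ((1ℚ + κ) * u - 1ℚ) + (1ℚ + κ) * t * ((dq + c) * t - 1ℚ))
        step₂ 0≤1 (*-nonNeg (*-nonNeg (*-nonNeg (<⇒≤ 1+κ-pos) t-nonNeg) t-nonNeg) (<⇒≤ κ-pos)) vanishing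
        (solve 7 (λ t k y w s f u → Dᴾ y :* (con 1ℚ :+ k) :* (f :* u :+ 2ᴾ :* t :* t) :- Dᴾ y :* (con 1ℚ :+ k) :* (:- w)
            := con 1ℚ :* (((con 1ℚ :+ k) :* t :+ Dᴾ y :* f) :- (:- w) :* Dᴾ y :* (con 1ℚ :+ k))
               :+ (con 1ℚ :+ k) :* t :* t :* k
               :+ (Dᴾ y :* f :* ((con 1ℚ :+ k) :* u :- con 1ℚ) :+ (con 1ℚ :+ k) :* t :* ((y :+ cᴾ y k) :* t :- con 1ℚ)))
          refl t κ dq w (nonAdj i₀ x) (x j) u)

    Q-≤ : Q ≤ x j * u + η
    Q-≤ = ≤-trans bound (≤-reflexive (cong (λ z → x j * u + z) (≡-sym η≡2t²)))
      where
      bound : Q ≤ x j * u + two * t * t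
      bound with Adj G i₀ j in adj
      ... | true = Q-≤-adjacent adj
      ... | false = Q-≤-nonAdjacent adj

  column-bound : ∀ i → ¬ i ≡ j → ∣ x i ∣ ≤ x j * u + η
  column-bound i i≢j = ≤-trans (offColumn-∣∣≤ i i≢j) (AtMinimum.Q-≤ (argmin-off-column i≢j))

mainTheorem6 : (m d : ℕ) (G : SimpleGraph (suc m)) →
    Connected G → IsRegular G d → suc m < 2 ℕ.* d ℕ.+ 2 →
    (X : Matrix (suc m)) → IsMoorePenroseInverse (laplacian G) X →
    ∀ (i j : Fin (suc m)) → ¬ (i ≡ j) →
    ∣ X i j ∣ ≤ maxDiag X * (+ 1 / suc (2 ℕ.* d ℕ.+ 2 ∸ suc m)) + (+ 2 / (suc m ℕ.* suc m))
mainTheorem6 m d G connected regular dense X mp i j i≢j = begin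
    ∣ X i j ∣            ≤⟨ column-bound i i≢j ⟩
    X j j * u + η        ≤⟨ +-monoˡ-≤ η (*-monoʳ-≤-nonNeg u {{normalize-nonNeg 1 (suc (2 ℕ.* d ℕ.+ 2 ∸ suc m))}} (maxFin-≥ (λ k → X k k) j)) ⟩
    maxDiag X * u + η    ∎
  where
  open ≤-Reasoning
  open MoorePenrose G connected X mp using (LX≡; X-colsum)
  open ColumnBound G regular dense j (λ k → X k j) (X-colsum j) (λ k → LX≡ k j) using (column-bound; u; η)
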